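{- Let $n\ge2$, $1\le r\le n$, and write $\mathrm{st}^r_n(q)=\sum_\alpha c^r_\alpha(q)M_\alpha$. Then for every composition $\alpha$ of $n$ and every $k$, $$[q^k]c^r_\alpha(q)=[q^{n-1-k}]c^{n+1-r}_\alpha(q)\qquad\text{and}\qquad[q^k]c^r_\alpha(q)=[q^{n-1-k}]c^r_{\alpha^{rev}}(q).$$
   Context: The star graph $\mathrm{St}_n$ has $n$ vertices, a root $v_0$, and edges exactly $\{v_0,v\}$ for $v\ne v_0$. A labeling is a bijection $L:V\to\{1,\dots,n\}$; a proper coloring is $\kappa:V\to\mathbb{Z}_{>0}$ with adjacent vertices colored differently; $\mathrm{asc}^L(\kappa)$ counts edges $\{u,v\}$ with $L(u)<L(v)$ and $\kappa(u)<\kappa(v)$; $\chi^L_G(x;q)=\sum_\kappa q^{\mathrm{asc}^L(\kappa)}x^\kappa$ with $x^\kappa=\prod_j x_j^{\#\kappa^{ -1}(j)}$. $\mathrm{st}^r_n(q)=\chi^L_{\mathrm{St}_n}(x;q)$ for any labeling $L$ with $L(v_0)=r$ (independent of this choice). $M_\alpha=\sum_{i_1<\dots<i_\ell}x_{i_1}^{\alpha_1}\cdots x_{i_\ell}^{\alpha_\ell}$; $\alpha^{rev}=(\alpha_\ell,\dots,\alpha_1)$. -}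

module Defs where

open import Data.Nat using (ℕ; zero; suc; _+_; _≤_; _<ᵇ_; _≡ᵇ_)
open import Data.Bool using (Bool; true; false; _∧_; _∨_; not)
open import Data.Fin using (Fin; zero; suc; toℕ)
open import Data.List using (List; []; _∷_; concatMap; map; filterᵇ; length; allFin; foldr)
open import Data.Vec using (Vec; []; _∷_; lookup; toList; sum)
open import Data.Vec.Relation.Unary.All using (All)
open import Data.Product using (_×_)
open import Relation.Binary.PropositionalEquality using (_≡_)

-- Star graph St_n with n = suc m vertices: vertex set Fin (suc m), root v0 = zero,
-- edges exactly {zero, suc i} for i : Fin m.
-- A labeling is L : Fin (suc m) → Fin (suc m) (required injective, hence bijective
-- in the statement); the label of v is toℕ (L v) + 1 ∈ {1..n}.
-- A colouring whose monomial x^κ is x_1^{α_1} ⋯ x_ℓ^{α_ℓ} takes values in {1..ℓ};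
-- we represent it as a vector κ : Vec (Fin ℓ) n, colour c : Fin ℓ meaning c + 1.

allB : ∀ {A : Set} → (A → Bool) → List A → Bool
allB p = foldr (λ a b → p a ∧ b) true

allCol : (n ℓ : ℕ) → List (Vec (Fin ℓ) n)
allCol zero ℓ = [] ∷ []
allCol (suc n) ℓ = concatMap (λ c → map (c ∷_) (allCol n ℓ)) (allFin ℓ)

_<F_ : ∀ {k} → Fin k → Fin k → Bool
a <F b = toℕ a <ᵇ toℕ b

_=F_ : ∀ {k} → Fin k → Fin k → Bool
a =F b = toℕ a ≡ᵇ toℕ b

mult : ∀ {n ℓ} → Vec (Fin ℓ) n → Fin ℓ → ℕ
mult κ j = length (filterᵇ (λ c → c =F j) (toList κ))

hasType : ∀ {n ℓ} → Vec (Fin ℓ) n → Vec ℕ ℓ → Bool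
hasType {ℓ = ℓ} κ α = allB (λ j → mult κ j ≡ᵇ lookup α j) (allFin ℓ)

proper : ∀ {m ℓ} → Vec (Fin ℓ) (suc m) → Bool
proper {m} κ = allB (λ i → not (lookup κ zero =F lookup κ (suc i))) (allFin m)

ascEdge : ∀ {m ℓ} → (Fin (suc m) → Fin (suc m)) → Vec (Fin ℓ) (suc m) →
          Fin (suc m) → Fin (suc m) → Bool
ascEdge L κ u v = ((L u <F L v) ∧ (lookup κ u <F lookup κ v))
                ∨ ((L v <F L u) ∧ (lookup κ v <F lookup κ u))

asc : ∀ {m ℓ} → (Fin (suc m) → Fin (suc m)) → Vec (Fin ℓ) (suc m) → ℕ
asc {m} L κ = length (filterᵇ (λ i → ascEdge L κ zero (suc i)) (allFin m))

-- [q^k] c_α(q), where χ^L_{St_{suc m}}(x;q) = Σ_α c_α(q) M_α: the coefficient of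
-- M_α is the coefficient of the monomial x_1^{α_1}⋯x_ℓ^{α_ℓ}, i.e. the number of
-- proper colourings κ with x^κ = x_1^{α_1}⋯x_ℓ^{α_ℓ} and asc^L(κ) = k.
coeff : ∀ {m ℓ} → (Fin (suc m) → Fin (suc m)) → Vec ℕ ℓ → ℕ → ℕ
coeff {m} {ℓ} L α k =
  length (filterᵇ (λ κ → proper κ ∧ hasType κ α ∧ (asc L κ ≡ᵇ k)) (allCol (suc m) ℓ))

IsComposition : ∀ {ℓ} → ℕ → Vec ℕ ℓ → Set
IsComposition n α = All (λ a → 1 ≤ a) α × sum α ≡ n

{-# OPTIONS --safe #-}
module Submission where

-- On a proper colouring every edge of the star joins distinct labels and distinct colours, so
-- reversing all labels (a ↦ n + 1 − a) or all colours (c ↦ ℓ + 1 − c) turns each of the n − 1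
-- edges from an ascent into a non-ascent and back: k ascents become n − 1 − k. Reversing colours
-- maps the colourings of type α bijectively onto those of type α^rev, which gives the second
-- identity. Reversing labels sends the root label r to n + 1 − r, and the coefficients depend on a
-- labelling only through its root label, since two labellings with the same root label differ by a
-- permutation of the vertices fixing the root; this gives the first identity.

open import Defs
open import Data.Bool using (Bool; true; false; not; _∧_; _∨_; T)
open import Data.Bool.ListAction using (all)
open import Data.Bool.Properties using (∨-comm)
open import Data.Empty using (⊥-elim)
open import Data.Fin as Fin using (Fin; zero; suc; toℕ; opposite; fromℕ; inject₁; punchOut)
open import Data.Fin.Permutation using (Permutation′; permutation; _⟨$⟩ʳ_; _⟨$⟩ˡ_; inverseˡ; inverseʳ; _∘ₚ_; flip)
import Data.Fin.Permutation as Permutation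
open import Data.Fin.Properties using (0≢1+n; toℕ-injective; toℕ<n; opposite-prop; opposite-involutive; any?; punchOut-injective; injective⇒≤)
open import Data.List as List using (List; []; _∷_; length; filterᵇ; allFin)
open import Data.List.Membership.Propositional using (_∈_)
open import Data.List.Membership.Propositional.Properties using (∈-map⁺; ∈-map⁻; ∈-concat⁺′; ∈-allFin)
open import Data.List.Membership.Propositional.Properties.WithK using (unique∧set⇒bag)
import Data.List.Properties as List
open import Data.List.Relation.Binary.BagAndSetEquality using (∼bag⇒↭)
open import Data.List.Relation.Binary.Disjoint.Propositional using (Disjoint)
open import Data.List.Relation.Binary.Permutation.Propositional using (_↭_; module PermutationReasoning)
open import Data.List.Relation.Binary.Permutation.Propositional.Properties using (↭-length; filter-↭)
import Data.List.Relation.Binary.Permutation.Propositional.Properties as ↭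
import Data.List.Relation.Unary.All as All
import Data.List.Relation.Unary.All.Properties as Allₚ
import Data.List.Relation.Unary.AllPairs as AllPairs
import Data.List.Relation.Unary.AllPairs.Properties as AllPairsₚ
open import Data.List.Relation.Unary.Any using (here)
open import Data.List.Relation.Unary.Unique.Propositional using (Unique)
import Data.List.Relation.Unary.Unique.Propositional.Properties as Unique
open import Data.Nat as ℕ using (ℕ; suc; _+_; _∸_; _≤_; _<ᵇ_; _≡ᵇ_)
open import Data.Nat.Properties using (≡ᵇ⇒≡; ≡⇒≡ᵇ; <ᵇ⇒<; <⇒<ᵇ; <-irrefl; +-comm; +-suc; +-cancelˡ-≡; +-cancelʳ-≡; +-∸-comm; suc-injective; ∸-monoʳ-<; ∸-cancelʳ-<)
open import Data.Product using (_×_; _,_; ∃; proj₁; proj₂)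
open import Data.Vec as Vec using (Vec; []; _∷_; lookup; reverse; _∷ʳ_; toList)
open import Data.Vec.Properties using (map-∘; map-cong; map-id; reverse-∷; lookup∘tabulate; tabulate∘lookup; tabulate-cong; lookup-map; toList-map)
open import Function using (_∘_; _↔_; _⇔_; Inverse; Equivalence; mk↔ₛ′; mk⇔; Injection)
open import Function.Construct.Identity using (↔-id)
open import Function.Definitions using (Injective)
open import Function.Properties.Inverse using (↔⇒↣)
open import Relation.Binary.PropositionalEquality using (_≡_; _≢_; _≗_; refl; sym; trans; cong; subst; module ≡-Reasoning)
open import Relation.Nullary using (¬_; yes; no)
open import Relation.Nullary.Decidable using (T?)

open Equivalence using (to; from)

private variable
  A B : Set
  m n ℓ : ℕ

↔-injective : (f : A ↔ B) → Injective _≡_ _≡_ (Inverse.to f)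
↔-injective f = Injection.injective (↔⇒↣ f)

count : (A → Bool) → List A → ℕ
count p xs = length (filterᵇ p xs)

count-cong : {p q : A → Bool} → p ≗ q → ∀ xs → count p xs ≡ count q xs
count-cong p≗q [] = refl
count-cong {p = p} {q} p≗q (x ∷ xs) with p x | q x | p≗q x
... | true  | .true  | refl = cong suc (count-cong p≗q xs)
... | false | .false | refl = count-cong p≗q xs

count-↭ : (p : A → Bool) {xs ys : List A} → xs ↭ ys → count p xs ≡ count p ys
count-↭ p xs↭ys = ↭-length (filter-↭ (T? ∘ p) xs↭ys)

count-map : (p : B → Bool) (f : A → B) (xs : List A) → count p (List.map f xs) ≡ count (p ∘ f) xs
count-map p f [] = refl
count-map p f (x ∷ xs) with p (f x)
... | true  = cong suc (count-map p f xs)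
... | false = count-map p f xs

count-not+count : (p : A → Bool) (xs : List A) → count (not ∘ p) xs + count p xs ≡ length xs
count-not+count p [] = refl
count-not+count p (x ∷ xs) with p x
... | true  = trans (+-suc _ _) (cong suc (count-not+count p xs))
... | false = cong suc (count-not+count p xs)

map-↭ : (f : A ↔ A) {xs : List A} → Unique xs → (∀ x → x ∈ xs) → List.map (Inverse.to f) xs ↭ xs
map-↭ f {xs} xs-unique ∈xs = ∼bag⇒↭ (unique∧set⇒bag
  (Unique.map⁺ (↔-injective f) xs-unique) xs-unique
  (λ {y} → mk⇔ (λ _ → ∈xs y) (λ _ → subst (_∈ List.map (Inverse.to f) xs)
    (Inverse.strictlyInverseˡ f y) (∈-map⁺ (Inverse.to f) (∈xs (Inverse.from f y))))))

count-↔ : (f : A ↔ A) {xs : List A} → Unique xs → (∀ x → x ∈ xs) →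
          (p : A → Bool) → count p xs ≡ count (p ∘ Inverse.to f) xs
count-↔ f {xs} xs-unique ∈xs p =
  trans (sym (count-↭ p (map-↭ f xs-unique ∈xs))) (count-map p (Inverse.to f) xs)

count-permute : (σ : Permutation′ n) (p : Fin n → Bool) →
                count p (allFin n) ≡ count (p ∘ (σ ⟨$⟩ʳ_)) (allFin n)
count-permute {n} σ = count-↔ σ (Unique.allFin⁺ n) ∈-allFin

T-ext : {x y : Bool} → (T x → T y) → (T y → T x) → x ≡ y
T-ext {false} {false} _ _ = refl
T-ext {false} {true}  _ g = ⊥-elim (g _)
T-ext {true}  {false} f _ = ⊥-elim (f _)
T-ext {true}  {true}  _ _ = refl

<ᵇ-irrefl : ∀ a → (a <ᵇ a) ≡ false
<ᵇ-irrefl ℕ.zero = refl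
<ᵇ-irrefl (suc a) = <ᵇ-irrefl a

<ᵇ-flip : ∀ {a b} → a ≢ b → (b <ᵇ a) ≡ not (a <ᵇ b)
<ᵇ-flip {ℕ.zero} {ℕ.zero} a≢b = ⊥-elim (a≢b refl)
<ᵇ-flip {ℕ.zero} {suc b}  _   = refl
<ᵇ-flip {suc a}  {ℕ.zero} _   = refl
<ᵇ-flip {suc a}  {suc b}  a≢b = <ᵇ-flip (a≢b ∘ cong suc)

≡ᵇ-complement : ∀ a b {k j s} → a + b ≡ s → k + j ≡ s → (a ≡ᵇ j) ≡ (b ≡ᵇ k)
≡ᵇ-complement a b {k} {j} a+b≡s k+j≡s =
  T-ext (≡⇒≡ᵇ b k ∘ b≡k ∘ ≡ᵇ⇒≡ a j) (≡⇒≡ᵇ a j ∘ a≡j ∘ ≡ᵇ⇒≡ b k)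
  where
  b≡k : a ≡ j → b ≡ k
  b≡k refl = +-cancelˡ-≡ a b k (trans a+b≡s (trans (sym k+j≡s) (+-comm k a)))
  a≡j : b ≡ k → a ≡ j
  a≡j refl = +-cancelʳ-≡ b a j (trans a+b≡s (trans (sym k+j≡s) (+-comm b j)))

<F-flip : {a b : Fin n} → a ≢ b → (b <F a) ≡ not (a <F b)
<F-flip a≢b = <ᵇ-flip (a≢b ∘ toℕ-injective)

opposite-<F : (a b : Fin n) → (opposite a <F opposite b) ≡ (b <F a)
opposite-<F {n} a b rewrite opposite-prop a | opposite-prop b =
  T-ext (λ lt → <⇒<ᵇ (ℕ.s<s⁻¹ (∸-cancelʳ-< {o = n} (<ᵇ⇒< (n ∸ suc (toℕ a)) _ lt))))
        (λ lt → <⇒<ᵇ (∸-monoʳ-< (ℕ.s<s (<ᵇ⇒< (toℕ b) _ lt)) (toℕ<n a)))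

=F⇒≡ : {a b : Fin n} → T (a =F b) → a ≡ b
=F⇒≡ {a = a} {b} = toℕ-injective ∘ ≡ᵇ⇒≡ (toℕ a) (toℕ b)

≡⇒=F : {a b : Fin n} → a ≡ b → T (a =F b)
≡⇒=F {a = a} refl = ≡⇒≡ᵇ (toℕ a) (toℕ a) refl

=F-permute : (π : Permutation′ n) (a b : Fin n) → ((π ⟨$⟩ʳ a) =F b) ≡ (a =F (π ⟨$⟩ˡ b))
=F-permute π a b = T-ext
  (λ πa=b → ≡⇒=F (trans (sym (inverseˡ π)) (cong (π ⟨$⟩ˡ_) (=F⇒≡ πa=b))))
  (λ a=πb → ≡⇒=F (trans (cong (π ⟨$⟩ʳ_) (=F⇒≡ a=πb)) (inverseʳ π)))

lookup-∷ʳ-fromℕ : (xs : Vec A n) (x : A) → lookup (xs ∷ʳ x) (fromℕ n) ≡ x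
lookup-∷ʳ-fromℕ []       x = refl
lookup-∷ʳ-fromℕ (y ∷ xs) x = lookup-∷ʳ-fromℕ xs x

lookup-∷ʳ-inject₁ : (xs : Vec A n) (x : A) (i : Fin n) → lookup (xs ∷ʳ x) (inject₁ i) ≡ lookup xs i
lookup-∷ʳ-inject₁ (y ∷ xs) x zero    = refl
lookup-∷ʳ-inject₁ (y ∷ xs) x (suc i) = lookup-∷ʳ-inject₁ xs x i

lookup-reverse : (xs : Vec A n) (i : Fin n) → lookup (reverse xs) (opposite i) ≡ lookup xs i
lookup-reverse (x ∷ xs) zero rewrite reverse-∷ x xs = lookup-∷ʳ-fromℕ (reverse xs) x
lookup-reverse (x ∷ xs) (suc i) rewrite reverse-∷ x xs =
  trans (lookup-∷ʳ-inject₁ (reverse xs) x (opposite i)) (lookup-reverse xs i)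

toList≡map-lookup : (xs : Vec A n) → toList xs ≡ List.map (lookup xs) (allFin n)
toList≡map-lookup xs = trans (toList≡tabulate xs) (sym (List.map-tabulate (λ v → v) (lookup xs)))
  where
  toList≡tabulate : (xs : Vec A n) → toList xs ≡ List.tabulate (lookup xs)
  toList≡tabulate []       = refl
  toList≡tabulate (x ∷ xs) = cong (x ∷_) (toList≡tabulate xs)

-- A map missing y would factor through Fin n by punching y out, contradicting the pigeonhole principle.
injective⇒surjective : {f : Fin n → Fin n} → Injective _≡_ _≡_ f → ∀ y → ∃ λ x → f x ≡ y
injective⇒surjective {n = suc n} {f = f} f-inj y with any? (λ x → f x Fin.≟ y)
... | yes fx≡y = fx≡y
... | no y∉image = ⊥-elim (<-irrefl refl (injective⇒≤ g-inj))
  where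
  y≢f : ∀ x → y ≢ f x
  y≢f x y≡fx = y∉image (x , sym y≡fx)
  g : Fin (suc n) → Fin n
  g x = punchOut (y≢f x)
  g-inj : Injective _≡_ _≡_ g
  g-inj {x} {x′} gx≡gx′ = f-inj (punchOut-injective (y≢f x) (y≢f x′) gx≡gx′)

injective⇒permutation : {f : Fin n → Fin n} → Injective _≡_ _≡_ f → Permutation′ n
injective⇒permutation {f = f} f-inj =
  permutation f (proj₁ ∘ surj) (proj₂ ∘ surj) (λ x → f-inj (proj₂ (surj (f x))))
  where surj = injective⇒surjective f-inj

permute : Permutation′ n → Vec A n → Vec A n
permute σ xs = Vec.tabulate (λ v → lookup xs (σ ⟨$⟩ʳ v))

lookup-permute : (σ : Permutation′ n) (xs : Vec A n) (v : Fin n) →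
                 lookup (permute σ xs) v ≡ lookup xs (σ ⟨$⟩ʳ v)
lookup-permute σ xs = lookup∘tabulate (λ v → lookup xs (σ ⟨$⟩ʳ v))

permute-flip : (σ : Permutation′ n) (xs : Vec A n) → permute (flip σ) (permute σ xs) ≡ xs
permute-flip σ xs = trans
  (tabulate-cong (λ v → trans (lookup-permute σ xs (σ ⟨$⟩ˡ v)) (cong (lookup xs) (inverseʳ σ))))
  (tabulate∘lookup xs)

permute-↔ : Permutation′ n → Vec A n ↔ Vec A n
permute-↔ σ = mk↔ₛ′ (permute σ) (permute (flip σ)) (permute-flip (flip σ)) (permute-flip σ)

toList-permute : (σ : Permutation′ n) (xs : Vec A n) → toList (permute σ xs) ↭ toList xs
toList-permute {n} σ xs = begin
  toList (permute σ xs)                                 ≡⟨ toList≡map-lookup (permute σ xs) ⟩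
  List.map (lookup (permute σ xs)) (allFin n)           ≡⟨ List.map-cong (lookup-permute σ xs) (allFin n) ⟩
  List.map (lookup xs ∘ (σ ⟨$⟩ʳ_)) (allFin n)           ≡⟨ List.map-∘ (allFin n) ⟩
  List.map (lookup xs) (List.map (σ ⟨$⟩ʳ_) (allFin n))
    ↭⟨ ↭.map⁺ (lookup xs) (map-↭ σ (Unique.allFin⁺ n) ∈-allFin) ⟩
  List.map (lookup xs) (allFin n)                       ≡⟨ toList≡map-lookup xs ⟨
  toList xs                                             ∎
  where open PermutationReasoning

∈-allCol : (κ : Vec (Fin ℓ) n) → κ ∈ allCol n ℓ
∈-allCol []      = here refl
∈-allCol {ℓ} (c ∷ κ) =
  ∈-concat⁺′ (∈-map⁺ (c ∷_) (∈-allCol κ)) (∈-map⁺ (λ c → List.map (c ∷_) (allCol _ ℓ)) (∈-allFin c))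

allCol-unique : ∀ n → Unique (allCol n ℓ)
allCol-unique ℕ.zero    = All.[] AllPairs.∷ AllPairs.[]
allCol-unique {ℓ} (suc n) = Unique.concat⁺
  (Allₚ.map⁺ (All.tabulate (λ _ → Unique.map⁺ ∷-injectiveʳ (allCol-unique n))))
  (AllPairsₚ.map⁺ (AllPairs.map disjoint (Unique.allFin⁺ ℓ)))
  where
  ∷-injectiveʳ : {c : Fin ℓ} {κ κ′ : Vec (Fin ℓ) n} → c ∷ κ ≡ c ∷ κ′ → κ ≡ κ′
  ∷-injectiveʳ refl = refl
  disjoint : {c d : Fin ℓ} → c ≢ d → Disjoint (List.map (c ∷_) (allCol n ℓ)) (List.map (d ∷_) (allCol n ℓ))
  disjoint c≢d (c∷κ∈ , d∷κ′∈) with ∈-map⁻ _ c∷κ∈ | ∈-map⁻ _ d∷κ′∈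
  ... | _ , _ , refl | _ , _ , refl = c≢d refl

Colouring : ℕ → ℕ → Set
Colouring m ℓ = Vec (Fin ℓ) (suc m)

Labelling : ℕ → Set
Labelling m = Fin (suc m) → Fin (suc m)

ascent : Fin n → Fin n → Fin ℓ → Fin ℓ → Bool
ascent a b x y = ((a <F b) ∧ (x <F y)) ∨ ((b <F a) ∧ (y <F x))

ascent-cong : {a a′ b b′ : Fin n} {x x′ y y′ : Fin ℓ} →
              a ≡ a′ → b ≡ b′ → x ≡ x′ → y ≡ y′ → ascent a b x y ≡ ascent a′ b′ x′ y′
ascent-cong refl refl refl refl = refl

ascent-refl : (a : Fin n) (x y : Fin ℓ) → ascent a a x y ≡ false
ascent-refl a x y rewrite <ᵇ-irrefl (toℕ a) = refl

ascent-swap : {a b : Fin n} {x y : Fin ℓ} → a ≢ b → x ≢ y → ascent b a x y ≡ not (ascent a b x y)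
ascent-swap {a = a} {b} {x} {y} a≢b x≢y rewrite <F-flip a≢b | <F-flip x≢y with a <F b | x <F y
... | true  | true  = refl
... | true  | false = refl
... | false | true  = refl
... | false | false = refl

ascent-sym : (a b : Fin n) (x y : Fin ℓ) → ascent a b y x ≡ ascent b a x y
ascent-sym a b x y = ∨-comm ((a <F b) ∧ (y <F x)) ((b <F a) ∧ (x <F y))

ascent-opposite-labels : (a b : Fin n) (x y : Fin ℓ) → ascent (opposite a) (opposite b) x y ≡ ascent b a x y
ascent-opposite-labels a b x y rewrite opposite-<F a b | opposite-<F b a = refl

ascent-opposite-colours : (a b : Fin n) (x y : Fin ℓ) → ascent a b (opposite x) (opposite y) ≡ ascent a b y x
ascent-opposite-colours a b x y rewrite opposite-<F x y | opposite-<F y x = refl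

allB≡all : (p : A → Bool) (xs : List A) → allB p xs ≡ all p xs
allB≡all p []       = refl
allB≡all p (x ∷ xs) = cong (p x ∧_) (allB≡all p xs)

T-allB-allFin : {p : Fin n → Bool} → T (allB p (allFin n)) ⇔ (∀ i → T (p i))
T-allB-allFin {n} {p} = mk⇔
  (λ h → Allₚ.tabulate⁻ (Allₚ.all⁺ p (allFin n) (subst T (allB≡all p (allFin n)) h)))
  (λ h → subst T (sym (allB≡all p (allFin n))) (Allₚ.all⁻ p (Allₚ.tabulate⁺ h)))

T-not : {x : Bool} → T (not x) ⇔ (¬ T x)
T-not {false} = mk⇔ (λ _ ()) (λ _ → _)
T-not {true}  = mk⇔ (λ ()) (λ ¬t → ¬t _)

T-not-=F : {a b : Fin n} → T (not (a =F b)) ⇔ a ≢ b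
T-not-=F = mk⇔ (λ a≠ᵇb → to T-not a≠ᵇb ∘ ≡⇒=F) (λ a≢b → from T-not (a≢b ∘ =F⇒≡))

proper⇔ : (κ : Colouring m ℓ) → T (proper κ) ⇔ (∀ v → lookup κ v ≡ lookup κ zero → v ≡ zero)
proper⇔ κ = mk⇔
  (λ h → λ { zero    _     → refl
           ; (suc i) κᵢ≡κ₀ → ⊥-elim (to T-not-=F (to T-allB-allFin h i) (sym κᵢ≡κ₀)) })
  (λ h → from T-allB-allFin (λ i → from T-not-=F (λ κ₀≡κᵢ → 0≢1+n (sym (h (suc i) (sym κ₀≡κᵢ))))))

permute-proper : (σ : Permutation′ (suc m)) → σ ⟨$⟩ʳ zero ≡ zero →
                 (κ : Colouring m ℓ) → T (proper κ) → T (proper (permute σ κ))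
permute-proper σ σ₀≡0 κ κ-proper = from (proper⇔ (permute σ κ)) λ v κσᵥ≡κσ₀ →
  ↔-injective σ (trans (root-only (σ ⟨$⟩ʳ v) (begin
    lookup κ (σ ⟨$⟩ʳ v)        ≡⟨ lookup-permute σ κ v ⟨
    lookup (permute σ κ) v     ≡⟨ κσᵥ≡κσ₀ ⟩
    lookup (permute σ κ) zero  ≡⟨ lookup-permute σ κ zero ⟩
    lookup κ (σ ⟨$⟩ʳ zero)     ≡⟨ cong (lookup κ) σ₀≡0 ⟩
    lookup κ zero              ∎)) (sym σ₀≡0))
  where
  open ≡-Reasoning
  root-only = to (proper⇔ κ) κ-proper

proper-permute : (σ : Permutation′ (suc m)) → σ ⟨$⟩ʳ zero ≡ zero →
                 (κ : Colouring m ℓ) → proper (permute σ κ) ≡ proper κ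
proper-permute σ σ₀≡0 κ = T-ext
  (subst (T ∘ proper) (permute-flip σ κ) ∘ permute-proper (flip σ) σ⁻¹₀≡0 (permute σ κ))
  (permute-proper σ σ₀≡0 κ)
  where
  σ⁻¹₀≡0 : σ ⟨$⟩ˡ zero ≡ zero
  σ⁻¹₀≡0 = trans (cong (σ ⟨$⟩ˡ_) (sym σ₀≡0)) (inverseˡ σ)

recolour : Permutation′ ℓ → Vec (Fin ℓ) n ↔ Vec (Fin ℓ) n
recolour π =
  mk↔ₛ′ (Vec.map (π ⟨$⟩ʳ_)) (Vec.map (π ⟨$⟩ˡ_)) (map-inverse (inverseʳ π)) (map-inverse (inverseˡ π))
  where
  map-inverse : {f g : Fin ℓ → Fin ℓ} → (∀ {c} → f (g c) ≡ c) → ∀ κ → Vec.map f (Vec.map g κ) ≡ κ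
  map-inverse {f = f} {g} fg κ = trans (sym (map-∘ f g κ)) (trans (map-cong (λ _ → fg) κ) (map-id κ))

proper-recolour : (π : Permutation′ ℓ) (κ : Colouring m ℓ) → proper (Vec.map (π ⟨$⟩ʳ_) κ) ≡ proper κ
proper-recolour π κ = T-ext
  (λ h → from (proper⇔ κ) λ v κᵥ≡κ₀ → to (proper⇔ πκ) h v (from (πκᵥ≡πκ₀⇔κᵥ≡κ₀ v) κᵥ≡κ₀))
  (λ h → from (proper⇔ πκ) λ v πκᵥ≡πκ₀ → to (proper⇔ κ) h v (to (πκᵥ≡πκ₀⇔κᵥ≡κ₀ v) πκᵥ≡πκ₀))
  where
  πκ = Vec.map (π ⟨$⟩ʳ_) κ
  πκᵥ≡πκ₀⇔κᵥ≡κ₀ : ∀ v → (lookup πκ v ≡ lookup πκ zero) ⇔ (lookup κ v ≡ lookup κ zero)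
  πκᵥ≡πκ₀⇔κᵥ≡κ₀ v = mk⇔
    (λ e → ↔-injective π (trans (sym (lookup-map v _ κ)) (trans e (lookup-map zero _ κ))))
    (λ e → trans (lookup-map v _ κ) (trans (cong (π ⟨$⟩ʳ_) e) (sym (lookup-map zero _ κ))))

mult-permute : (σ : Permutation′ n) (κ : Vec (Fin ℓ) n) (c : Fin ℓ) → mult (permute σ κ) c ≡ mult κ c
mult-permute σ κ c = count-↭ (_=F c) (toList-permute σ κ)

mult-recolour : (π : Permutation′ ℓ) (κ : Vec (Fin ℓ) n) (c : Fin ℓ) →
                mult (Vec.map (π ⟨$⟩ʳ_) κ) c ≡ mult κ (π ⟨$⟩ˡ c)
mult-recolour π κ c = begin
  count (_=F c) (toList (Vec.map (π ⟨$⟩ʳ_) κ))    ≡⟨ cong (count (_=F c)) (toList-map (π ⟨$⟩ʳ_) κ) ⟩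
  count (_=F c) (List.map (π ⟨$⟩ʳ_) (toList κ))   ≡⟨ count-map (_=F c) (π ⟨$⟩ʳ_) (toList κ) ⟩
  count (λ d → (π ⟨$⟩ʳ d) =F c) (toList κ)        ≡⟨ count-cong (λ d → =F-permute π d c) (toList κ) ⟩
  count (_=F (π ⟨$⟩ˡ c)) (toList κ)               ∎
  where open ≡-Reasoning

hasType⇔ : (κ : Vec (Fin ℓ) n) (α : Vec ℕ ℓ) → T (hasType κ α) ⇔ (∀ c → mult κ c ≡ lookup α c)
hasType⇔ κ α = mk⇔
  (λ h c → ≡ᵇ⇒≡ (mult κ c) (lookup α c) (to T-allB-allFin h c))
  (λ h → from T-allB-allFin (λ c → ≡⇒≡ᵇ (mult κ c) (lookup α c) (h c)))

hasType-permute : (σ : Permutation′ n) (κ : Vec (Fin ℓ) n) (α : Vec ℕ ℓ) →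
                  hasType (permute σ κ) α ≡ hasType κ α
hasType-permute σ κ α = T-ext
  (λ h → from (hasType⇔ κ α) λ c → trans (sym (mult-permute σ κ c)) (to (hasType⇔ (permute σ κ) α) h c))
  (λ h → from (hasType⇔ (permute σ κ) α) λ c → trans (mult-permute σ κ c) (to (hasType⇔ κ α) h c))

hasType-reverse : (κ : Vec (Fin ℓ) n) (α : Vec ℕ ℓ) → hasType (Vec.map opposite κ) (reverse α) ≡ hasType κ α
hasType-reverse κ α = T-ext
  (λ h → from (hasType⇔ κ α) λ c → begin
    mult κ c                        ≡⟨ cong (mult κ) (opposite-involutive c) ⟨
    mult κ (opposite (opposite c))  ≡⟨ mult-recolour Permutation.reverse κ (opposite c) ⟨
    mult κ̅ (opposite c)             ≡⟨ to (hasType⇔ κ̅ (reverse α)) h (opposite c) ⟩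
    lookup (reverse α) (opposite c) ≡⟨ lookup-reverse α c ⟩
    lookup α c                      ∎)
  (λ h → from (hasType⇔ κ̅ (reverse α)) λ c → begin
    mult κ̅ c                                  ≡⟨ mult-recolour Permutation.reverse κ c ⟩
    mult κ (opposite c)                        ≡⟨ to (hasType⇔ κ α) h (opposite c) ⟩
    lookup α (opposite c)                      ≡⟨ lookup-reverse α (opposite c) ⟨
    lookup (reverse α) (opposite (opposite c)) ≡⟨ cong (lookup (reverse α)) (opposite-involutive c) ⟩
    lookup (reverse α) c                       ∎)
  where
  open ≡-Reasoning
  κ̅ = Vec.map opposite κ

root-colour≢leaf-colour : (κ : Colouring m ℓ) → T (proper κ) → ∀ i → lookup κ zero ≢ lookup κ (suc i)
root-colour≢leaf-colour κ κ-proper i κ₀≡κᵢ = 0≢1+n (sym (to (proper⇔ κ) κ-proper (suc i) (sym κ₀≡κᵢ)))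

asc≡count-allVertices : (L : Labelling m) (κ : Colouring m ℓ) →
                        asc L κ ≡ count (ascEdge L κ zero) (allFin (suc m))
asc≡count-allVertices {m} L κ = sym (begin
  count (ascEdge L κ zero) (zero ∷ List.tabulate suc)
    ≡⟨ cong length (List.filter-reject (T? ∘ ascEdge L κ zero) no-loop) ⟩
  count (ascEdge L κ zero) (List.tabulate suc)
    ≡⟨ cong (count (ascEdge L κ zero)) (List.map-tabulate (λ i → i) suc) ⟨
  count (ascEdge L κ zero) (List.map suc (allFin m))
    ≡⟨ count-map (ascEdge L κ zero) suc (allFin m) ⟩
  asc L κ
    ∎)
  where
  open ≡-Reasoning
  no-loop : ¬ T (ascEdge L κ zero zero)
  no-loop = subst T (ascent-refl (L zero) (lookup κ zero) (lookup κ zero))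

asc-complement : (L L′ : Labelling m) (κ κ′ : Colouring m ℓ) →
                 (∀ i → ascEdge L′ κ′ zero (suc i) ≡ not (ascEdge L κ zero (suc i))) →
                 asc L′ κ′ + asc L κ ≡ m
asc-complement {m} L L′ κ κ′ flips = trans
  (cong (_+ asc L κ) (count-cong flips (allFin m)))
  (trans (count-not+count _ (allFin m)) (List.length-tabulate (λ i → i)))

asc-reverse-labels : {L : Labelling m} → Injective _≡_ _≡_ L → (κ : Colouring m ℓ) → T (proper κ) →
                     asc (opposite ∘ L) κ + asc L κ ≡ m
asc-reverse-labels {L = L} L-inj κ κ-proper = asc-complement L (opposite ∘ L) κ κ λ i → trans
  (ascent-opposite-labels (L zero) (L (suc i)) (lookup κ zero) (lookup κ (suc i)))
  (ascent-swap (0≢1+n ∘ L-inj) (root-colour≢leaf-colour κ κ-proper i))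

asc-reverse-colours : {L : Labelling m} → Injective _≡_ _≡_ L → (κ : Colouring m ℓ) → T (proper κ) →
                      asc L (Vec.map opposite κ) + asc L κ ≡ m
asc-reverse-colours {L = L} L-inj κ κ-proper = asc-complement L L κ (Vec.map opposite κ) edge-flips
  where
  open ≡-Reasoning
  edge-flips : ∀ i → ascEdge L (Vec.map opposite κ) zero (suc i) ≡ not (ascEdge L κ zero (suc i))
  edge-flips i = begin
    ascent L₀ Lᵢ (lookup (Vec.map opposite κ) zero) (lookup (Vec.map opposite κ) (suc i))
      ≡⟨ ascent-cong {a = L₀} {b = Lᵢ} refl refl (lookup-map zero opposite κ) (lookup-map (suc i) opposite κ) ⟩
    ascent L₀ Lᵢ (opposite κ₀) (opposite κᵢ)  ≡⟨ ascent-opposite-colours L₀ Lᵢ κ₀ κᵢ ⟩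
    ascent L₀ Lᵢ κᵢ κ₀                        ≡⟨ ascent-sym L₀ Lᵢ κ₀ κᵢ ⟩
    ascent Lᵢ L₀ κ₀ κᵢ                        ≡⟨ ascent-swap (0≢1+n ∘ L-inj) (root-colour≢leaf-colour κ κ-proper i) ⟩
    not (ascent L₀ Lᵢ κ₀ κᵢ)                  ∎
    where
    L₀ = L zero
    Lᵢ = L (suc i)
    κ₀ = lookup κ zero
    κᵢ = lookup κ (suc i)

asc-permute : (σ : Permutation′ (suc m)) → σ ⟨$⟩ʳ zero ≡ zero →
              (L₁ L₂ : Labelling m) → (∀ v → L₂ (σ ⟨$⟩ʳ v) ≡ L₁ v) →
              (κ : Colouring m ℓ) → asc L₁ (permute σ κ) ≡ asc L₂ κ
asc-permute {m} σ σ₀≡0 L₁ L₂ L₂σ≡L₁ κ = begin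
  asc L₁ (permute σ κ)                                          ≡⟨ asc≡count-allVertices L₁ (permute σ κ) ⟩
  count (ascEdge L₁ (permute σ κ) zero) (allFin (suc m))        ≡⟨ count-cong edge-moves (allFin (suc m)) ⟩
  count (ascEdge L₂ κ zero ∘ (σ ⟨$⟩ʳ_)) (allFin (suc m))        ≡⟨ count-permute σ (ascEdge L₂ κ zero) ⟨
  count (ascEdge L₂ κ zero) (allFin (suc m))                    ≡⟨ asc≡count-allVertices L₂ κ ⟨
  asc L₂ κ                                                      ∎
  where
  open ≡-Reasoning
  edge-moves : ∀ v → ascEdge L₁ (permute σ κ) zero v ≡ ascEdge L₂ κ zero (σ ⟨$⟩ʳ v)
  edge-moves v = ascent-cong
    (trans (sym (L₂σ≡L₁ zero)) (cong L₂ σ₀≡0)) (sym (L₂σ≡L₁ v))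
    (trans (lookup-permute σ κ zero) (cong (lookup κ) σ₀≡0)) (lookup-permute σ κ v)

coeff-↔ : {L L′ : Labelling m} {α β : Vec ℕ ℓ} {k k′ : ℕ} (f : Colouring m ℓ ↔ Colouring m ℓ) →
          (∀ κ → proper (Inverse.to f κ) ≡ proper κ) →
          (∀ κ → hasType (Inverse.to f κ) β ≡ hasType κ α) →
          (∀ κ → T (proper κ) → (asc L′ (Inverse.to f κ) ≡ᵇ k′) ≡ (asc L κ ≡ᵇ k)) →
          coeff L′ β k′ ≡ coeff L α k
coeff-↔ {m} {ℓ} {L} {L′} {α} {β} {k} {k′} f proper-f hasType-f asc-f =
  trans (count-↔ f (allCol-unique (suc m)) ∈-allCol _) (count-cong same-count (allCol (suc m) ℓ))
  where
  same-count : ∀ κ → (proper (Inverse.to f κ) ∧ hasType (Inverse.to f κ) β ∧ (asc L′ (Inverse.to f κ) ≡ᵇ k′))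
                   ≡ (proper κ ∧ hasType κ α ∧ (asc L κ ≡ᵇ k))
  same-count κ rewrite proper-f κ | hasType-f κ with proper κ in κ-proper
  ... | false = refl
  ... | true  = cong (hasType κ α ∧_) (asc-f κ (subst T (sym κ-proper) _))

coeff-relabel : {L₁ L₂ : Labelling m} → Injective _≡_ _≡_ L₁ → Injective _≡_ _≡_ L₂ → L₁ zero ≡ L₂ zero →
                (α : Vec ℕ ℓ) (k : ℕ) → coeff L₁ α k ≡ coeff L₂ α k
coeff-relabel {L₁ = L₁} {L₂} L₁-inj L₂-inj L₁₀≡L₂₀ α k =
  coeff-↔ {L = L₂} {L₁} {α} {α} {k} {k} (permute-↔ σ)
    (proper-permute σ σ₀≡0) (λ κ → hasType-permute σ κ α)
    (λ κ _ → cong (_≡ᵇ k) (asc-permute σ σ₀≡0 L₁ L₂ L₂σ≡L₁ κ))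
  where
  π₂ = injective⇒permutation L₂-inj
  σ = injective⇒permutation L₁-inj ∘ₚ flip π₂
  L₂σ≡L₁ : ∀ v → L₂ (σ ⟨$⟩ʳ v) ≡ L₁ v
  L₂σ≡L₁ v = inverseʳ π₂
  σ₀≡0 : σ ⟨$⟩ʳ zero ≡ zero
  σ₀≡0 = L₂-inj (trans (L₂σ≡L₁ zero) L₁₀≡L₂₀)

coeff-reverse-labels : {L : Labelling m} → Injective _≡_ _≡_ L → (α : Vec ℕ ℓ) → ∀ {k j} → k + j ≡ m →
                       coeff (opposite ∘ L) α j ≡ coeff L α k
coeff-reverse-labels {L = L} L-inj α {k} {j} k+j≡m =
  coeff-↔ {L = L} {opposite ∘ L} {α} {α} {k} {j} (↔-id _) (λ _ → refl) (λ _ → refl) λ κ κ-proper →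
    ≡ᵇ-complement (asc (opposite ∘ L) κ) (asc L κ) (asc-reverse-labels L-inj κ κ-proper) k+j≡m

coeff-reverse-colours : {L : Labelling m} → Injective _≡_ _≡_ L → (α : Vec ℕ ℓ) → ∀ {k j} → k + j ≡ m →
                        coeff L (reverse α) j ≡ coeff L α k
coeff-reverse-colours {L = L} L-inj α {k} {j} k+j≡m =
  coeff-↔ {L = L} {L} {α} {reverse α} {k} {j} (recolour Permutation.reverse)
    (proper-recolour Permutation.reverse) (λ κ → hasType-reverse κ α) λ κ κ-proper →
      ≡ᵇ-complement (asc L (Vec.map opposite κ)) (asc L κ) (asc-reverse-colours L-inj κ κ-proper) k+j≡m

complementary-label⇒opposite : {i j : Fin n} → suc (toℕ j) ≡ n + 1 ∸ suc (toℕ i) → j ≡ opposite i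
complementary-label⇒opposite {n} {i} {j} eq = toℕ-injective (suc-injective (begin
  suc (toℕ j)              ≡⟨ eq ⟩
  n + 1 ∸ suc (toℕ i)      ≡⟨ +-∸-comm 1 (toℕ<n i) ⟩
  n ∸ suc (toℕ i) + 1      ≡⟨ +-comm _ 1 ⟩
  suc (n ∸ suc (toℕ i))    ≡⟨ cong suc (opposite-prop i) ⟨
  suc (toℕ (opposite i))   ∎))
  where open ≡-Reasoning

lemma4p3 : ∀ (m : ℕ) → 1 ≤ m → ∀ (r : ℕ) → 1 ≤ r → r ≤ suc m →
    ∀ (L L' : Fin (suc m) → Fin (suc m)) →
    Injective _≡_ _≡_ L → Injective _≡_ _≡_ L' →
    suc (toℕ (L zero)) ≡ r → suc (toℕ (L' zero)) ≡ suc m + 1 ∸ r →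
    ∀ (ℓ : ℕ) (α : Vec ℕ ℓ) → IsComposition (suc m) α →
    ∀ (k j : ℕ) → k + j ≡ m →
    (coeff L α k ≡ coeff L' α j) × (coeff L α k ≡ coeff L (reverse α) j)
lemma4p3 m _ _ _ _ L L′ L-inj L′-inj refl L′-root ℓ α _ k j k+j≡m =
    (begin
      coeff L α k              ≡⟨ coeff-reverse-labels L-inj α k+j≡m ⟨
      coeff (opposite ∘ L) α j ≡⟨ coeff-relabel opposite∘L-inj L′-inj opposite-L₀≡L′₀ α j ⟩
      coeff L′ α j             ∎)
  , sym (coeff-reverse-colours L-inj α k+j≡m)
  where
  open ≡-Reasoning
  opposite∘L-inj : Injective _≡_ _≡_ (opposite ∘ L)
  opposite∘L-inj = L-inj ∘ ↔-injective Permutation.reverse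
  opposite-L₀≡L′₀ : opposite (L zero) ≡ L′ zero
  opposite-L₀≡L′₀ = sym (complementary-label⇒opposite {i = L zero} L′-root)
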